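{- For every finite simple graph $G$ containing no triangle, $$\mathrm{cw}(G)\geqslant \frac12\,\delta(G)^2.$$
   Context: Cutwidth: for a graph $G=(V,E)$ and a linear ordering $\mathcal{O}=(x_1<\cdots<x_n)$ of $V$, set $\mathrm{cw}(G,\mathcal{O})=\max_{1\leqslant i\leqslant n}\#\{uv\in E : u\leqslant x_i<v\}$, and $\mathrm{cw}(G)=\min_{\mathcal{O}}\mathrm{cw}(G,\mathcal{O})$ over all linear orderings of $V$. Degeneracy: for an integer $k$, the $k$-core of $G$ is the subgraph obtained by recursively deleting vertices of degree strictly less than $k$; the degeneracy $\delta(G)$ is the largest $k$ such that the $k$-core of $G$ is nonempty. -}

module Defs where

open import Data.Bool using (Bool; true; false; _∧_; if_then_else_)
open import Data.Nat using (ℕ; zero; suc; _+_; _*_; _≤_; _<_; _≤ᵇ_; _<ᵇ_; _⊔_)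
open import Data.Fin using (Fin; toℕ)
open import Data.Fin.Permutation using (Permutation′; _⟨$⟩ʳ_)
open import Data.List using (List; []; _∷_; length; filterᵇ; allFin; concatMap; map; foldr; upTo)
open import Data.Product using (Σ; _×_; _,_; ∃-syntax)
open import Relation.Binary.PropositionalEquality using (_≡_)
open import Data.Empty using (⊥)

record Graph (n : ℕ) : Set where
  field
    adj    : Fin n → Fin n → Bool
    sym    : ∀ u v → adj u v ≡ adj v u
    irrefl : ∀ v → adj v v ≡ false
open Graph public

TriangleFree : ∀ {n} → Graph n → Set
TriangleFree G = ∀ u v w → adj G u v ≡ true → adj G v w ≡ true → adj G u w ≡ true → ⊥

-- A linear ordering of V = Fin n is a bijection O : V → positions (Fin n);
-- x < y in the ordering iff O x < O y.
Ordering : ℕ → Set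
Ordering n = Permutation′ n

-- number of edges uv with  pos u ≤ i < pos v  (each edge counted once)
cutAt : ∀ {n} → Graph n → Ordering n → Fin n → ℕ
cutAt {n} G O i =
  length (filterᵇ (λ p → pick p)
    (concatMap (λ u → map (λ v → u , v) (allFin n)) (allFin n)))
  where
  pick : Fin n × Fin n → Bool
  pick (u , v) = adj G u v ∧ (toℕ (O ⟨$⟩ʳ u) ≤ᵇ toℕ i) ∧ (toℕ i <ᵇ toℕ (O ⟨$⟩ʳ v))

cwOrd : ∀ {n} → Graph n → Ordering n → ℕ
cwOrd {n} G O = foldr _⊔_ 0 (map (cutAt G O) (allFin n))

IsCutwidth : ∀ {n} → Graph n → ℕ → Set
IsCutwidth G c = (∃[ O ] cwOrd G O ≡ c) × (∀ O → c ≤ cwOrd G O)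

Subset : ℕ → Set
Subset n = Fin n → Bool

degIn : ∀ {n} → Graph n → Subset n → Fin n → ℕ
degIn {n} G S v = length (filterᵇ (λ u → S u ∧ adj G v u) (allFin n))

prune : ∀ {n} → Graph n → ℕ → Subset n → Subset n
prune G k S v = S v ∧ (k ≤ᵇ degIn G S v)

iter : ∀ {A : Set} → ℕ → (A → A) → A → A
iter zero    f a = a
iter (suc m) f a = f (iter m f a)

-- the k-core: recursive deletion; n rounds suffice since every
-- non-final round deletes at least one vertex (afterwards it is stable).
core : ∀ {n} → Graph n → ℕ → Subset n
core {n} G k = iter n (prune G k) (λ _ → true)

coreSize : ∀ {n} → Graph n → ℕ → ℕ
coreSize {n} G k = length (filterᵇ (core G k) (allFin n))

nonemptyᵇ : ℕ → Bool
nonemptyᵇ zero    = false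
nonemptyᵇ (suc _) = true

-- degeneracy: largest k with nonempty k-core.  Degrees are < n, so the
-- k-core is empty for k > n; search k ∈ {0,…,n}.  (Convention: 0 for the
-- empty graph, where no core is nonempty.)
degeneracy : ∀ {n} → Graph n → ℕ
degeneracy {n} G =
  foldr _⊔_ 0 (map (λ k → if nonemptyᵇ (coreSize G k) then k else 0) (upTo (suc n)))

module Submission where

-- Let k = δ(G) ≥ 1 and fix any ordering O.  The k-core is nonempty, and the
-- stable iterate of the pruning process is a vertex set T in which every
-- vertex has at least k neighbours inside T; in particular |T| ≥ k.  Scanning
-- T along O, the prefix sizes grow by at most one per position, so some
-- prefix P = {v ∈ T : pos v ≤ t} has exactly k vertices.  Each u ∈ P has ≥ k
-- neighbours in T, each lying in P or after position t, hence
--     k·k = |P|·k ≤ Σ_{u∈P} deg_P u + (edges leaving P to the right)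
--                ≤ Σ_{u∈P} deg_P u + cut(t).
-- Mantel's theorem (in degree-sum form 2·Σ_{u∈P} deg_P u ≤ |P|²) bounds the
-- first summand by k·k/2, so k·k ≤ 2·cut(t) ≤ 2·cw(G,O).

open import Defs
open import Data.Nat using (ℕ; _*_; _≤_)
open import Data.Nat using (zero; suc; _+_; _∸_; _<_; _≤ᵇ_; _<ᵇ_; _≡ᵇ_; _⊔_; z≤n; s≤s; _≤?_)
open import Data.Nat.Properties
open import Data.Nat.Tactic.RingSolver using (solve-∀)
open import Data.Bool using (Bool; true; false; _∧_; not; if_then_else_)
open import Data.Bool.Properties using (T-≡)
open import Data.Fin using (Fin; zero; suc; toℕ; fromℕ<)
open import Data.Fin.Properties using (toℕ-injective; toℕ≤pred[n]; toℕ-fromℕ<)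
  renaming (suc-injective to Fin-suc-injective; 0≢1+n to Fin-0≢1+n)
open import Data.Fin.Permutation using (_⟨$⟩ʳ_; _⟨$⟩ˡ_; inverseˡ)
open import Data.List using (List; _∷_; _++_; length; filterᵇ; allFin; concatMap; map; foldr; upTo; tabulate)
open import Data.List.Properties using (length-++; filter-++; map-tabulate)
open import Data.List.Membership.Propositional using (_∈_)
open import Data.List.Membership.Propositional.Properties
  using (∈-allFin; ∈-map⁺; ∈-map⁻; foldr-selective)
open import Data.List.Relation.Unary.All using (lookup)
open import Data.List.Relation.Unary.Any using (here; there)
open import Data.List.Extrema.Nat using (argmax; f[xs]≤f[argmax])
open import Data.Product using (Σ; _×_; _,_)
open import Data.Sum using (_⊎_; inj₁; inj₂)
open import Data.Empty using (⊥-elim)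
open import Function using (_∘_; id; Equivalence)
open import Relation.Nullary using (yes; no; contradiction)
open import Relation.Binary.PropositionalEquality as ≡ using (_≡_; refl; cong; cong₂; subst)
open import Algebra.Properties.CommutativeMonoid.Sum +-0-commutativeMonoid
  using (sum; sum-cong-≗; sum-replicate-zero; ∑-distrib-+; ∑-comm)

open ≤-Reasoning

∧-intro : ∀ {a b} → a ≡ true → b ≡ true → a ∧ b ≡ true
∧-intro refl refl = refl

∧-elimˡ : ∀ {a b} → a ∧ b ≡ true → a ≡ true
∧-elimˡ {true} _ = refl

∧-elimʳ : ∀ {a b} → a ∧ b ≡ true → b ≡ true
∧-elimʳ {true} h = h

≤ᵇ-sound : ∀ {a b} → (a ≤ᵇ b) ≡ true → a ≤ b
≤ᵇ-sound {a} {b} h = ≤ᵇ⇒≤ a b (Equivalence.from T-≡ h)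

≤ᵇ-complete : ∀ {a b} → a ≤ b → (a ≤ᵇ b) ≡ true
≤ᵇ-complete h = Equivalence.to T-≡ (≤⇒≤ᵇ h)

≤ᵇ-false : ∀ {a b} → (a ≤ᵇ b) ≡ false → (b <ᵇ a) ≡ true
≤ᵇ-false {a} {b} h with a ≤? b
... | yes a≤b = contradiction (≡.trans (≡.sym h) (≤ᵇ-complete a≤b)) λ ()
... | no a≰b = Equivalence.to T-≡ (<⇒<ᵇ (≰⇒> a≰b))

≡ᵇ-sound : ∀ {a b} → (a ≡ᵇ b) ≡ true → a ≡ b
≡ᵇ-sound {a} {b} h = ≡ᵇ⇒≡ a b (Equivalence.from T-≡ h)

≡ᵇ-complete : ∀ {a b} → a ≡ b → (a ≡ᵇ b) ≡ true
≡ᵇ-complete {a} {b} e = Equivalence.to T-≡ (≡⇒≡ᵇ a b e)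

-- AM–GM in the form 4ab ≤ (a + b)², first for a ≤ b: writing b = a + t,
-- (a + (a + t))² = 4a(a + t) + t².
am-gm-≤ : ∀ {a b} → a ≤ b → 4 * (a * b) ≤ (a + b) * (a + b)
am-gm-≤ {a} {b} a≤b = subst (λ b → 4 * (a * b) ≤ (a + b) * (a + b)) (m+[n∸m]≡n a≤b)
  (≤-trans (m≤m+n _ ((b ∸ a) * (b ∸ a))) (≤-reflexive (expand a (b ∸ a))))
  where
  expand : ∀ a t → 4 * (a * (a + t)) + t * t ≡ (a + (a + t)) * (a + (a + t))
  expand = solve-∀

am-gm : ∀ a b → 4 * (a * b) ≤ (a + b) * (a + b)
am-gm a b with ≤-total a b
... | inj₁ a≤b = am-gm-≤ a≤b
... | inj₂ b≤a = ≡.subst₂ _≤_ (cong (4 *_) (*-comm b a)) (cong (λ m → m * m) (+-comm b a)) (am-gm-≤ b≤a)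

absorb : ∀ a x y → a ≤ x + y → 2 * x ≤ a → a ≤ 2 * y
absorb a x y a≤x+y 2x≤a = +-cancelˡ-≤ a a (2 * y) (begin
  a + a            ≡⟨ cong (a +_) (+-identityʳ a) ⟨
  2 * a            ≤⟨ *-monoʳ-≤ 2 a≤x+y ⟩
  2 * (x + y)      ≡⟨ *-distribˡ-+ 2 x y ⟩
  2 * x + 2 * y    ≤⟨ +-monoˡ-≤ (2 * y) 2x≤a ⟩
  a + 2 * y        ∎)

discrete-ivt : (h : ℕ → ℕ) → (∀ m → h (suc m) ≤ suc (h m)) →
  ∀ {d} N → h 0 ≤ d → d ≤ h N → Σ ℕ λ m → m ≤ N × h m ≡ d
discrete-ivt h step zero h0≤d d≤h0 = 0 , z≤n , ≤-antisym h0≤d d≤h0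
discrete-ivt h step {d} (suc N) h0≤d d≤hN with d ≤? h N
... | yes d≤hN′ = let m , m≤N , hm≡d = discrete-ivt h step N h0≤d d≤hN′
                  in m , m≤n⇒m≤1+n m≤N , hm≡d
... | no d≰hN′ = suc N , ≤-refl , ≤-antisym (≤-trans (step N) (≰⇒> d≰hN′)) d≤hN

≤-foldr-⊔ : ∀ {x xs} → x ∈ xs → x ≤ foldr _⊔_ 0 xs
≤-foldr-⊔ (here refl) = m≤m⊔n _ _
≤-foldr-⊔ {xs = y ∷ _} (there x∈xs) = ≤-trans (≤-foldr-⊔ x∈xs) (m≤n⊔m y _)

sum-mono : ∀ {n} {f g : Fin n → ℕ} → (∀ x → f x ≤ g x) → sum f ≤ sum g
sum-mono {zero} _ = z≤n
sum-mono {suc n} f≤g = +-mono-≤ (f≤g zero) (sum-mono (f≤g ∘ suc))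

sum-tight : ∀ {n} {f g : Fin n → ℕ} → (∀ x → f x ≤ g x) → sum g ≤ sum f → ∀ x → g x ≤ f x
sum-tight {suc n} {f} {g} f≤g Σg≤Σf zero = +-cancelʳ-≤ (sum (g ∘ suc)) (g zero) (f zero) (begin
  g zero + sum (g ∘ suc)  ≤⟨ Σg≤Σf ⟩
  f zero + sum (f ∘ suc)  ≤⟨ +-monoʳ-≤ (f zero) (sum-mono (f≤g ∘ suc)) ⟩
  f zero + sum (g ∘ suc)  ∎)
sum-tight {suc n} {f} {g} f≤g Σg≤Σf (suc x) = sum-tight (f≤g ∘ suc) (+-cancelˡ-≤ (g zero) _ _ (begin
  g zero + sum (g ∘ suc)  ≤⟨ Σg≤Σf ⟩
  f zero + sum (f ∘ suc)  ≤⟨ +-monoˡ-≤ (sum (f ∘ suc)) (f≤g zero) ⟩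
  g zero + sum (f ∘ suc)  ∎)) x

𝟙 : Bool → ℕ
𝟙 b = if b then 1 else 0

∑∈ : ∀ {n} → Subset n → (Fin n → ℕ) → ℕ
∑∈ P f = sum (λ x → if P x then f x else 0)

∣_∣ : ∀ {n} → Subset n → ℕ
∣ P ∣ = sum (λ x → 𝟙 (P x))

_⊆_ : ∀ {n} → Subset n → Subset n → Set
P ⊆ Q = ∀ x → P x ≡ true → Q x ≡ true

_∩_ : ∀ {n} → Subset n → Subset n → Subset n
(P ∩ Q) x = P x ∧ Q x

∁ : ∀ {n} → Subset n → Subset n
∁ P x = not (P x)

∑∈-mono : ∀ {n} (P : Subset n) {f g : Fin n → ℕ} → (∀ x → P x ≡ true → f x ≤ g x) → ∑∈ P f ≤ ∑∈ P g
∑∈-mono P f≤g = sum-mono pointwise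
  where
  pointwise : ∀ x → (if P x then _ else 0) ≤ (if P x then _ else 0)
  pointwise x with P x in Px
  ... | true = f≤g x Px
  ... | false = z≤n

∑∈-+ : ∀ {n} (P : Subset n) (f g : Fin n → ℕ) → ∑∈ P (λ x → f x + g x) ≡ ∑∈ P f + ∑∈ P g
∑∈-+ P f g = ≡.trans (sum-cong-≗ pointwise)
  (∑-distrib-+ (λ x → if P x then f x else 0) (λ x → if P x then g x else 0))
  where
  pointwise : ∀ x → (if P x then f x + g x else 0) ≡ (if P x then f x else 0) + (if P x then g x else 0)
  pointwise x with P x
  ... | true = refl
  ... | false = refl

∑∈-const : ∀ {n} (P : Subset n) c → ∑∈ P (λ _ → c) ≡ ∣ P ∣ * c
∑∈-const {zero} P c = refl
∑∈-const {suc n} P c with P zero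
... | true = cong (c +_) (∑∈-const (P ∘ suc) c)
... | false = ∑∈-const (P ∘ suc) c

𝟙-mono : ∀ {a b} → (a ≡ true → b ≡ true) → 𝟙 a ≤ 𝟙 b
𝟙-mono {false} _ = z≤n
𝟙-mono {true} a⇒b rewrite a⇒b refl = ≤-refl

𝟙-true : ∀ {b} → 1 ≤ 𝟙 b → b ≡ true
𝟙-true {true} _ = refl

count-mono : ∀ {n} {P Q : Subset n} → P ⊆ Q → ∣ P ∣ ≤ ∣ Q ∣
count-mono P⊆Q = sum-mono (λ x → 𝟙-mono (P⊆Q x))

count-union : ∀ {n} {P Q R : Subset n} → (∀ x → P x ≡ true → Q x ≡ true ⊎ R x ≡ true) →
  ∣ P ∣ ≤ ∣ Q ∣ + ∣ R ∣
count-union {P = P} {Q} {R} P⊆Q∪R =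
  ≤-trans (sum-mono pointwise) (≤-reflexive (∑-distrib-+ (λ x → 𝟙 (Q x)) (λ x → 𝟙 (R x))))
  where
  pointwise : ∀ x → 𝟙 (P x) ≤ 𝟙 (Q x) + 𝟙 (R x)
  pointwise x with P x in Px
  ... | false = z≤n
  ... | true with P⊆Q∪R x Px
  ...   | inj₁ Qx rewrite Qx = s≤s z≤n
  ...   | inj₂ Rx rewrite Rx = m≤n+m 1 (𝟙 (Q x))

count-split : ∀ {n} (P Q : Subset n) → ∣ P ∣ ≡ ∣ P ∩ Q ∣ + ∣ P ∩ ∁ Q ∣
count-split P Q = ≡.trans (sum-cong-≗ pointwise)
  (∑-distrib-+ (λ x → 𝟙 (P x ∧ Q x)) (λ x → 𝟙 (P x ∧ not (Q x))))
  where
  pointwise : ∀ x → 𝟙 (P x) ≡ 𝟙 (P x ∧ Q x) + 𝟙 (P x ∧ not (Q x))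
  pointwise x with P x | Q x
  ... | false | _ = refl
  ... | true | true = refl
  ... | true | false = refl

count≤n : ∀ {n} (P : Subset n) → ∣ P ∣ ≤ n
count≤n {zero} P = z≤n
count≤n {suc n} P = +-mono-≤ (𝟙≤1 (P zero)) (count≤n (P ∘ suc))
  where
  𝟙≤1 : ∀ b → 𝟙 b ≤ 1
  𝟙≤1 true = ≤-refl
  𝟙≤1 false = z≤n

count≤1 : ∀ {n} (P : Subset n) → (∀ x y → P x ≡ true → P y ≡ true → x ≡ y) → ∣ P ∣ ≤ 1
count≤1 {zero} P unique = z≤n
count≤1 {suc n} P unique with P zero in P0
... | true = s≤s (≤-trans (count-mono nothing-else) (≤-reflexive (sum-replicate-zero n)))
  where
  nothing-else : (P ∘ suc) ⊆ (λ _ → false)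
  nothing-else x Px = contradiction (unique zero (suc x) P0 Px) Fin-0≢1+n
... | false = count≤1 (P ∘ suc) (λ x y Px Py → Fin-suc-injective (unique (suc x) (suc y) Px Py))

member⇒nonempty : ∀ {n} (P : Subset n) x → P x ≡ true → 1 ≤ ∣ P ∣
member⇒nonempty P zero P0 rewrite P0 = s≤s z≤n
member⇒nonempty P (suc x) Px = ≤-trans (member⇒nonempty (P ∘ suc) x Px) (m≤n+m _ _)

nonempty⇒member : ∀ {n} (P : Subset n) → 1 ≤ ∣ P ∣ → Σ (Fin n) λ x → P x ≡ true
nonempty⇒member {suc n} P nonempty with P zero in P0
... | true = zero , P0
... | false = let x , Px = nonempty⇒member (P ∘ suc) nonempty in suc x , Px

count-tight : ∀ {n} {P Q : Subset n} → Q ⊆ P → ∣ P ∣ ≤ ∣ Q ∣ → P ⊆ Q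
count-tight {P = P} Q⊆P ∣P∣≤∣Q∣ x Px =
  𝟙-true (≤-trans (≤-reflexive (cong 𝟙 (≡.sym Px))) (sum-tight (λ y → 𝟙-mono (Q⊆P y)) ∣P∣≤∣Q∣ x))

length-filter-tabulate : ∀ {A : Set} {m} (p : A → Bool) (g : Fin m → A) →
  length (filterᵇ p (tabulate g)) ≡ ∣ p ∘ g ∣
length-filter-tabulate {m = zero} p g = refl
length-filter-tabulate {m = suc m} p g with p (g zero)
... | true = cong suc (length-filter-tabulate p (g ∘ suc))
... | false = length-filter-tabulate p (g ∘ suc)

length-filter-concatMap : ∀ {A B : Set} {m} (p : B → Bool) (f : A → List B) (g : Fin m → A) →
  length (filterᵇ p (concatMap f (tabulate g))) ≡ sum (λ x → length (filterᵇ p (f (g x))))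
length-filter-concatMap {m = zero} p f g = refl
length-filter-concatMap {m = suc m} p f g = begin-equality
  length (filterᵇ p (f (g zero) ++ rest))
    ≡⟨ cong length (filter-++ _ (f (g zero)) rest) ⟩
  length (filterᵇ p (f (g zero)) ++ filterᵇ p rest)
    ≡⟨ length-++ (filterᵇ p (f (g zero))) ⟩
  length (filterᵇ p (f (g zero))) + length (filterᵇ p rest)
    ≡⟨ cong (length (filterᵇ p (f (g zero))) +_) (length-filter-concatMap p f (g ∘ suc)) ⟩
  sum (λ x → length (filterᵇ p (f (g x))))  ∎
  where
  rest : List _
  rest = concatMap f (tabulate (g ∘ suc))

≤-cwOrd : ∀ {n} (G : Graph n) (O : Ordering n) (i : Fin n) → cutAt G O i ≤ cwOrd G O
≤-cwOrd {n} G O i = ≤-foldr-⊔ (∈-map⁺ (cutAt G O) (∈-allFin i))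

-- Degrees, double counting and Mantel's theorem

deg : ∀ {n} → Graph n → Subset n → Fin n → ℕ
deg G S u = ∣ S ∩ adj G u ∣

degIn≡deg : ∀ {n} (G : Graph n) (S : Subset n) u → degIn G S u ≡ deg G S u
degIn≡deg G S u = length-filter-tabulate (λ v → S v ∧ adj G u v) id

MinDegree≥ : ∀ {n} → Graph n → Subset n → ℕ → Set
MinDegree≥ G S k = ∀ x → S x ≡ true → k ≤ deg G S x

min-degree-size : ∀ {n} (G : Graph n) (S : Subset n) k → MinDegree≥ G S k →
  ∀ {v} → S v ≡ true → k ≤ ∣ S ∣
min-degree-size G S k min-degree {v} Sv =
  ≤-trans (min-degree v Sv) (count-mono λ u h → ∧-elimˡ {S u} h)

-- Double counting: both sides count the edges uv with u ∈ X and v ∈ Y.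
∑∈-deg-swap : ∀ {n} (G : Graph n) (X Y : Subset n) → ∑∈ X (deg G Y) ≡ ∑∈ Y (deg G X)
∑∈-deg-swap {n} G X Y = begin-equality
  ∑∈ X (deg G Y)       ≡⟨ sum-cong-≗ (λ u → restrict (X u) (Y ∩ adj G u)) ⟩
  sum (λ u → sum (λ v → edge u v))  ≡⟨ ∑-comm edge ⟩
  sum (λ v → sum (λ u → edge u v))  ≡⟨ sum-cong-≗ (λ v → sum-cong-≗ (λ u → cong 𝟙 (flip u v))) ⟩
  sum (λ v → sum (λ u → 𝟙 (Y v ∧ (X u ∧ adj G v u))))
                       ≡⟨ sum-cong-≗ (λ v → restrict (Y v) (X ∩ adj G v)) ⟨
  ∑∈ Y (deg G X)       ∎
  where
  edge : Fin n → Fin n → ℕ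
  edge u v = 𝟙 (X u ∧ (Y v ∧ adj G u v))
  restrict : ∀ b (Q : Subset n) → (if b then ∣ Q ∣ else 0) ≡ ∣ (λ v → b ∧ Q v) ∣
  restrict true Q = refl
  restrict false Q = ≡.sym (sum-replicate-zero n)
  flip : ∀ u v → X u ∧ (Y v ∧ adj G u v) ≡ Y v ∧ (X u ∧ adj G v u)
  flip u v rewrite Graph.sym G u v with X u | Y v
  ... | true | _ = refl
  ... | false | true = refl
  ... | false | false = refl

-- Take w of maximum degree Δ into P and R = P minus the neighbours of w.
-- The neighbours of w are independent, so every edge of G[P] meets R, and
-- Σ_{u∈P} deg_P u ≤ 2·Σ_{u∈R} deg_P u ≤ 2|R|Δ ≤ (|R| + Δ)²/2 = |P|²/2.
mantel-at-max-degree : ∀ {n} (G : Graph n) → TriangleFree G → (P : Subset n) (w : Fin n) →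
  (∀ u → deg G P u ≤ deg G P w) → 2 * ∑∈ P (deg G P) ≤ ∣ P ∣ * ∣ P ∣
mantel-at-max-degree {n} G tf P w maximal = begin
  2 * ∑∈ P (deg G P)          ≤⟨ *-monoʳ-≤ 2 edges-meet-R ⟩
  2 * (∣ R ∣ * Δ + ∣ R ∣ * Δ)  ≡⟨ cong (λ m → 2 * (∣ R ∣ * Δ + m)) (+-identityʳ (∣ R ∣ * Δ)) ⟨
  2 * (2 * (∣ R ∣ * Δ))       ≡⟨ *-assoc 2 2 (∣ R ∣ * Δ) ⟨
  4 * (∣ R ∣ * Δ)             ≤⟨ am-gm ∣ R ∣ Δ ⟩
  (∣ R ∣ + Δ) * (∣ R ∣ + Δ)    ≡⟨ cong (λ m → m * m) P-split ⟨
  ∣ P ∣ * ∣ P ∣               ∎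
  where
  Δ : ℕ
  Δ = deg G P w
  R : Subset n
  R = P ∩ ∁ (adj G w)

  P-split : ∣ P ∣ ≡ ∣ R ∣ + Δ
  P-split = ≡.trans (count-split P (adj G w)) (+-comm Δ ∣ R ∣)

  -- a P-neighbour of a neighbour of w is not adjacent to w, so lies in R
  independent : ∀ u → adj G w u ≡ true → (P ∩ adj G u) ⊆ (R ∩ adj G u)
  independent u wu v Pv∧uv with adj G w v in wv
  ... | true = ⊥-elim (tf w u v wu (∧-elimʳ {P v} Pv∧uv) wv)
  ... | false = ∧-intro (∧-intro (∧-elimˡ {P v} Pv∧uv) refl) (∧-elimʳ {P v} Pv∧uv)

  edges-meet-R : ∑∈ P (deg G P) ≤ ∣ R ∣ * Δ + ∣ R ∣ * Δ
  edges-meet-R = begin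
    ∑∈ P (deg G P)                    ≤⟨ sum-mono pointwise ⟩
    sum (λ u → (if R u then deg G P u else 0) + (if P u then deg G R u else 0))
                                      ≡⟨ ∑-distrib-+ (λ u → if R u then deg G P u else 0)
                                                     (λ u → if P u then deg G R u else 0) ⟩
    ∑∈ R (deg G P) + ∑∈ P (deg G R)   ≡⟨ cong (∑∈ R (deg G P) +_) (∑∈-deg-swap G P R) ⟩
    ∑∈ R (deg G P) + ∑∈ R (deg G P)   ≤⟨ +-mono-≤ bound bound ⟩
    ∣ R ∣ * Δ + ∣ R ∣ * Δ              ∎
    where
    pointwise : ∀ u → (if P u then deg G P u else 0) ≤
                      (if R u then deg G P u else 0) + (if P u then deg G R u else 0)
    pointwise u with P u | adj G w u in wu
    ... | false | _ = z≤n
    ... | true | false = m≤m+n _ _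
    ... | true | true = count-mono (independent u wu)
    bound : ∑∈ R (deg G P) ≤ ∣ R ∣ * Δ
    bound = ≤-trans (∑∈-mono R (λ u _ → maximal u)) (≤-reflexive (∑∈-const R Δ))

mantel : ∀ {n} (G : Graph n) → TriangleFree G → (P : Subset n) →
  2 * ∑∈ P (deg G P) ≤ ∣ P ∣ * ∣ P ∣
mantel {zero} G tf P = z≤n
mantel {suc n} G tf P = mantel-at-max-degree G tf P w maximal
  where
  w : Fin (suc n)
  w = argmax (deg G P) zero (allFin (suc n))
  maximal : ∀ u → deg G P u ≤ deg G P w
  maximal u = lookup (f[xs]≤f[argmax] {f = deg G P} zero (allFin (suc n))) (∈-allFin u)

-- The k-core: stabilisation of the pruning process

module Iteration {n : ℕ} (f : Subset n → Subset n) (shrinking : ∀ S → f S ⊆ S) (S₀ : Subset n) where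

  S : ℕ → Subset n
  S j = iter j f S₀

  later⊆earlier : ∀ m j → S (m + j) ⊆ S j
  later⊆earlier zero j x Sx = Sx
  later⊆earlier (suc m) j x Sx = later⊆earlier m j x (shrinking (S (m + j)) x Sx)

  progress : ∀ m → (Σ ℕ λ j → j < m × ∣ S j ∣ ≤ ∣ S (suc j) ∣) ⊎ (∣ S m ∣ + m ≤ n)
  progress zero = inj₂ (≤-trans (≤-reflexive (+-identityʳ _)) (count≤n S₀))
  progress (suc m) with progress m
  ... | inj₁ (j , j<m , stalled) = inj₁ (j , m<n⇒m<1+n j<m , stalled)
  ... | inj₂ removed with ∣ S m ∣ ≤? ∣ S (suc m) ∣
  ...   | yes stalled = inj₁ (m , ≤-refl , stalled)
  ...   | no shrank = inj₂ (begin
          ∣ S (suc m) ∣ + suc m  ≡⟨ +-suc _ m ⟩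
          suc ∣ S (suc m) ∣ + m  ≤⟨ +-monoˡ-≤ m (≰⇒> shrank) ⟩
          ∣ S m ∣ + m            ≤⟨ removed ⟩
          n                      ∎)

  fixpoint : Σ ℕ λ j → S n ⊆ S j × S j ⊆ f (S j)
  fixpoint with progress n
  ... | inj₁ (j , j<n , stalled) =
          j , subst (λ m → S m ⊆ S j) (m∸n+n≡m (<⇒≤ j<n)) (later⊆earlier (n ∸ j) j)
            , count-tight (shrinking (S j)) stalled
  ... | inj₂ removed = n , (λ x Sx → Sx) , λ x Sx →
          contradiction (≤-trans (+-monoˡ-≤ n (member⇒nonempty (S n) x Sx)) removed) 1+n≰n

core-min-degree : ∀ {n} (G : Graph n) (k : ℕ) {v} → core G k v ≡ true →
  Σ (Subset n) λ S → S v ≡ true × MinDegree≥ G S k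
core-min-degree G k {v} v∈core with fixpoint
  where open Iteration (prune G k) (λ S x → ∧-elimˡ {S x}) (λ _ → true)
... | j , core⊆Sj , Sj-stable = S , core⊆Sj v v∈core , min-degree
  where
  S : Subset _
  S = iter j (prune G k) (λ _ → true)
  min-degree : MinDegree≥ G S k
  min-degree x Sx = subst (k ≤_) (degIn≡deg G S x) (≤ᵇ-sound (∧-elimʳ {S x} (Sj-stable x Sx)))

degeneracy-witness : ∀ {n} (G : Graph n) →
  degeneracy G ≡ 0 ⊎ Σ ℕ λ k → degeneracy G ≡ k × Σ (Fin n) λ v → core G k v ≡ true
degeneracy-witness {n} G with foldr-selective ⊔-sel 0 (map candidate (upTo (suc n)))
  where
  candidate : ℕ → ℕ
  candidate k = if nonemptyᵇ (coreSize G k) then k else 0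
... | inj₁ δ≡0 = inj₁ δ≡0
... | inj₂ δ∈ with ∈-map⁻ _ δ∈
...   | k , _ , δ≡k with coreSize G k in size
...     | zero = inj₁ δ≡k
...     | suc m = inj₂ (k , δ≡k , nonempty⇒member (core G k) (begin
            1                                       ≤⟨ s≤s z≤n ⟩
            suc m                                   ≡⟨ size ⟨
            coreSize G k                            ≡⟨ length-filter-tabulate (core G k) id ⟩
            ∣ core G k ∣                             ∎))

module _ {n : ℕ} (O : Ordering n) where

  pos : Fin n → ℕ
  pos v = toℕ (O ⟨$⟩ʳ v)

  pos-injective : ∀ {u v} → pos u ≡ pos v → u ≡ v
  pos-injective {u} {v} e =
    ≡.trans (≡.sym (inverseˡ O)) (≡.trans (cong (O ⟨$⟩ˡ_) (toℕ-injective e)) (inverseˡ O))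

  before after : ℕ → Subset n
  before t v = pos v ≤ᵇ t
  after t v = t <ᵇ pos v

  prefix-start : ∀ T → ∣ T ∩ before 0 ∣ ≤ 1
  prefix-start T = count≤1 _ λ x y x≤0 y≤0 → pos-injective (≡.trans (at0 x x≤0) (≡.sym (at0 y y≤0)))
    where
    at0 : ∀ x → (T ∩ before 0) x ≡ true → pos x ≡ 0
    at0 x x≤0 = n≤0⇒n≡0 (≤ᵇ-sound {pos x} {0} (∧-elimʳ {T x} x≤0))

  prefix-step : ∀ T m → ∣ T ∩ before (suc m) ∣ ≤ suc ∣ T ∩ before m ∣
  prefix-step T m = begin
    ∣ T ∩ before (suc m) ∣           ≤⟨ count-union split ⟩
    ∣ T ∩ before m ∣ + ∣ at (suc m) ∣ ≤⟨ +-monoʳ-≤ _ (count≤1 (at (suc m)) at-unique) ⟩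
    ∣ T ∩ before m ∣ + 1             ≡⟨ +-comm _ 1 ⟩
    suc ∣ T ∩ before m ∣             ∎
    where
    at : ℕ → Subset n
    at j v = pos v ≡ᵇ j
    at-unique : ∀ x y → at (suc m) x ≡ true → at (suc m) y ≡ true → x ≡ y
    at-unique x y x-there y-there = pos-injective (≡.trans (≡ᵇ-sound x-there) (≡.sym (≡ᵇ-sound y-there)))
    split : ∀ x → (T ∩ before (suc m)) x ≡ true → (T ∩ before m) x ≡ true ⊎ at (suc m) x ≡ true
    split x h with m≤n⇒m<n∨m≡n (≤ᵇ-sound {pos x} {suc m} (∧-elimʳ {T x} h))
    ... | inj₁ x<sm = inj₁ (∧-intro (∧-elimˡ {T x} h) (≤ᵇ-complete (≤-pred x<sm)))
    ... | inj₂ x≡sm = inj₂ (≡ᵇ-complete x≡sm)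

prefix-of-size : ∀ {n} (O : Ordering n) (T : Subset n) {d} → 1 ≤ d → d ≤ ∣ T ∣ →
  Σ (Fin n) λ t → ∣ T ∩ before O (toℕ t) ∣ ≡ d
prefix-of-size {zero} O T 1≤d d≤0 = contradiction (≤-trans 1≤d d≤0) λ ()
prefix-of-size {suc n} O T {d} 1≤d d≤∣T∣
  with discrete-ivt (λ t → ∣ T ∩ before O t ∣) (prefix-step O T) n
         (≤-trans (prefix-start O T) 1≤d) (≤-trans d≤∣T∣ (count-mono whole))
  where
  whole : T ⊆ (T ∩ before O n)
  whole x Tx = ∧-intro Tx (≤ᵇ-complete (toℕ≤pred[n] (O ⟨$⟩ʳ x)))
... | t , t≤n , size≡d =
  fromℕ< (s≤s t≤n) , ≡.trans (cong (λ t → ∣ T ∩ before O t ∣) (toℕ-fromℕ< (s≤s t≤n))) size≡d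

module _ {n : ℕ} (G : Graph n) (O : Ordering n) where

  crossing : ℕ → Fin n → Subset n
  crossing t u v = adj G u v ∧ (pos O u ≤ᵇ t) ∧ (t <ᵇ pos O v)

  cut : ℕ → ℕ
  cut t = sum (λ u → ∣ crossing t u ∣)

  cut≤cwOrd : ∀ i → cut (toℕ i) ≤ cwOrd G O
  cut≤cwOrd i = ≤-trans (≤-reflexive (≡.sym cutAt≡cut)) (≤-cwOrd G O i)
    where
    cutAt≡cut : cutAt G O i ≡ cut (toℕ i)
    cutAt≡cut = ≡.trans (length-filter-concatMap crosses (λ u → map (u ,_) (allFin n)) id)
      (sum-cong-≗ λ u → ≡.trans (cong (length ∘ filterᵇ crosses) (map-tabulate id (u ,_)))
                                (length-filter-tabulate crosses (u ,_)))
      where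
      crosses : Fin n × Fin n → Bool
      crosses (u , v) = crossing (toℕ i) u v

  -- If every vertex of T has at least d neighbours in T and the prefix
  -- P = {v ∈ T : pos v ≤ t} has exactly d elements, then d² ≤ 2·cut t:
  -- d² ≤ Σ_{u∈P} deg_P u + (edges from P to later vertices of T), and
  -- Mantel bounds the first term by d²/2.
  prefix-cut-bound : TriangleFree G → (T : Subset n) (t d : ℕ) → MinDegree≥ G T d →
    ∣ T ∩ before O t ∣ ≡ d → d * d ≤ 2 * cut t
  prefix-cut-bound tf T t d min-degree ∣P∣≡d = begin
    d * d                    ≤⟨ absorb (d * d) (∑∈ P (deg G P)) (∑∈ P (deg G Q)) degree-sum mantel-bound ⟩
    2 * ∑∈ P (deg G Q)       ≤⟨ *-monoʳ-≤ 2 leaving≤cut ⟩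
    2 * cut t                ∎
    where
    P Q : Subset n
    P = T ∩ before O t
    Q = T ∩ after O t

    -- a neighbour inside T lies in P or after position t
    degree-split : ∀ u → deg G T u ≤ deg G P u + deg G Q u
    degree-split u = count-union split
      where
      split : ∀ v → (T ∩ adj G u) v ≡ true → (P ∩ adj G u) v ≡ true ⊎ (Q ∩ adj G u) v ≡ true
      split v h with pos O v ≤ᵇ t in v≤t
      ... | true = inj₁ (∧-intro (∧-intro (∧-elimˡ {T v} h) refl) (∧-elimʳ {T v} h))
      ... | false = inj₂ (∧-intro (∧-intro (∧-elimˡ {T v} h) (≤ᵇ-false {pos O v} {t} v≤t)) (∧-elimʳ {T v} h))

    -- the edges from P to Q cross position t
    leaving≤cut : ∑∈ P (deg G Q) ≤ cut t
    leaving≤cut = sum-mono pointwise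
      where
      pointwise : ∀ u → (if P u then deg G Q u else 0) ≤ ∣ crossing t u ∣
      pointwise u with P u in Pu
      ... | false = z≤n
      ... | true = count-mono λ v h →
              ∧-intro (∧-elimʳ {Q v} h) (∧-intro (∧-elimʳ {T u} Pu) (∧-elimʳ {T v} (∧-elimˡ {Q v} h)))

    degree-sum : d * d ≤ ∑∈ P (deg G P) + ∑∈ P (deg G Q)
    degree-sum = begin
      d * d                                   ≡⟨ cong (_* d) ∣P∣≡d ⟨
      ∣ P ∣ * d                                ≡⟨ ∑∈-const P d ⟨
      ∑∈ P (λ _ → d)                          ≤⟨ ∑∈-mono P (λ u Pu → min-degree u (∧-elimˡ {T u} Pu)) ⟩
      ∑∈ P (deg G T)                          ≤⟨ ∑∈-mono P (λ u _ → degree-split u) ⟩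
      ∑∈ P (λ u → deg G P u + deg G Q u)      ≡⟨ ∑∈-+ P _ _ ⟩
      ∑∈ P (deg G P) + ∑∈ P (deg G Q)         ∎

    mantel-bound : 2 * ∑∈ P (deg G P) ≤ d * d
    mantel-bound = ≤-trans (mantel G tf P) (≤-reflexive (cong₂ _*_ ∣P∣≡d ∣P∣≡d))

min-degree-cutwidth : ∀ {n} (G : Graph n) → TriangleFree G → (T : Subset n) (v : Fin n) →
  T v ≡ true → ∀ k → MinDegree≥ G T k → (O : Ordering n) → k * k ≤ 2 * cwOrd G O
min-degree-cutwidth G tf T v Tv zero min-degree O = z≤n
min-degree-cutwidth G tf T v Tv k@(suc _) min-degree O
  with t , ∣prefix∣≡k ← prefix-of-size O T (s≤s z≤n) (min-degree-size G T k min-degree Tv) = begin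
  k * k                ≤⟨ prefix-cut-bound G O tf T (toℕ t) k min-degree ∣prefix∣≡k ⟩
  2 * cut G O (toℕ t)  ≤⟨ *-monoʳ-≤ 2 (cut≤cwOrd G O t) ⟩
  2 * cwOrd G O        ∎

degeneracy-cutwidth : ∀ {n} (G : Graph n) → TriangleFree G → (O : Ordering n) →
  degeneracy G * degeneracy G ≤ 2 * cwOrd G O
degeneracy-cutwidth G tf O with degeneracy-witness G
... | inj₁ δ≡0 rewrite δ≡0 = z≤n
... | inj₂ (k , δ≡k , v , v∈core) rewrite δ≡k with core-min-degree G k v∈core
...   | T , Tv , min-degree = min-degree-cutwidth G tf T v Tv k min-degree O

-- Corollary: δ(G)² ≤ 2·cw(G); only an ordering attaining c is needed.
corollary2p3 : ∀ (n : ℕ) (G : Graph n) → TriangleFree G →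
    (c : ℕ) → IsCutwidth G c →
    degeneracy G * degeneracy G ≤ 2 * c
corollary2p3 n G tf c ((O , cw≡c) , _) = begin
  degeneracy G * degeneracy G  ≤⟨ degeneracy-cutwidth G tf O ⟩
  2 * cwOrd G O                ≡⟨ cong (2 *_) cw≡c ⟩
  2 * c                        ∎
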